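{- For every base $\mathcal{B}$, atomic multiset $L$ and formulae $\varphi,\psi$: if $\varphi\Vdash^{L}_{\mathcal{B}}\psi$, then $!\varphi\Vdash^{L}_{\mathcal{B}}\psi$.
   Context: Fix a set $\mathbb{A}$ of propositional atoms. All multisets are finite; $\uplus$ denotes multiset union; an atomic multiset is a finite multiset of atoms. Formulae: $\varphi ::= p\in\mathbb{A}\mid\top\mid 0\mid 1\mid\varphi\multimap\varphi\mid\varphi\otimes\varphi\mid\varphi\mathbin{\&}\varphi\mid\varphi\oplus\varphi\mid\,!\varphi$. Bases. An atomic sequent is a pair $P\Rightarrow p$ ($P$ atomic multiset, $p$ atom); an atomic box is a finite multiset of atomic sequents; an atomic rule is a triple $\langle\mathbf{A},\mathbf{S},p\rangle$ with $\mathbf{A}$ a finite multiset of atomic boxes, $\mathbf{S}$ an atomic box, $p$ an atom. A base is a set of atomic rules; $\mathcal{C}\supseteq\mathcal{B}$ is set inclusion. An atom $p$ is persistent in $\mathcal{B}$ if $\mathcal{B}$ contains a rule $\langle\varnothing,\mathbf{S},p\rangle$ with $\mathbf{S}\neq\varnothing$. Derivability $P\vdash_{\mathcal{B}}p$ is the smallest relation closed under: (Ref) $\{p\}\vdash_{\mathcal{B}}p$; (App) if $\langle\mathbf{A},\mathbf{S},p\rangle\in\mathcal{B}$ with $\mathbf{A}=\{\mathbf{T}_1,\dots,\mathbf{T}_m\}$, and there are $n\ge m$, atomic multisets $C_1,\dots,C_n$ and a multiset $D=\{d_{m+1},\dots,d_n\}$ of atoms persistent in $\mathcal{B}$ with $C_i\uplus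 Q\vdash_{\mathcal{B}}q$ for all $i\le m$ and $Q\Rightarrow q\in\mathbf{T}_i$, $C_j\vdash_{\mathcal{B}}d_j$ for all $m<j\le n$, and $D\uplus U\vdash_{\mathcal{B}}v$ for all $U\Rightarrow v\in\mathbf{S}$, then $C_1\uplus\dots\uplus C_n\vdash_{\mathcal{B}}p$. Support. For a base $\mathcal{B}$, atomic multiset $L$: (At) $\Vdash^L_{\mathcal{B}}p$ iff $L\vdash_{\mathcal{B}}p$; ($\multimap$) $\Vdash^L_{\mathcal{B}}\varphi\multimap\psi$ iff $\varphi\Vdash^L_{\mathcal{B}}\psi$; ($\otimes$) $\Vdash^L_{\mathcal{B}}\varphi\otimes\psi$ iff for all $\mathcal{C}\supseteq\mathcal{B}$, atomic multisets $K$, atoms $p$: if $\{\varphi,\psi\}\Vdash^K_{\mathcal{C}}p$ then $\Vdash^{L\uplus K}_{\mathcal{C}}p$; ($1$) $\Vdash^L_{\mathcal{B}}1$ iff for all $\mathcal{C}\supseteq\mathcal{B}$, $K$, $p$: if $\Vdash^K_{\mathcal{C}}p$ then $\Vdash^{L\uplus K}_{\mathcal{C}}p$; ($\mathbin{\&}$) $\Vdash^L_{\mathcal{B}}\varphi\mathbin{\&}\psi$ iff $\Vdash^L_{\mathcal{B}}\varphi$ and $\Vdash^L_{\mathcal{B}}\psi$; ($\oplus$) $\Vdash^L_{\mathcal{B}}\varphi\oplus\psi$ iff for all $\mathcal{C}\supseteq\mathcal{B}$, $K$, $p$: if $\varphi\Vdash^K_{\mathcal{C}}p$ and $\psi\Vdash^K_{\mathcal{C}}p$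 then $\Vdash^{L\uplus K}_{\mathcal{C}}p$; ($0$) $\Vdash^L_{\mathcal{B}}0$ iff $\Vdash^{L\uplus K}_{\mathcal{B}}p$ for all atoms $p$ and atomic multisets $K$; ($\top$) $\Vdash^L_{\mathcal{B}}\top$ always; ($!$) $\Vdash^L_{\mathcal{B}}\,!\varphi$ iff for all $\mathcal{C}\supseteq\mathcal{B}$, $K$, $p$: if (for all $\mathcal{D}\supseteq\mathcal{C}$, $\Vdash^{\varnothing}_{\mathcal{D}}\varphi$ implies $\Vdash^K_{\mathcal{D}}p$) then $\Vdash^{L\uplus K}_{\mathcal{C}}p$. Multisets: $\Vdash^L_{\mathcal{B}}\varnothing$ iff $L=\varnothing$; $\Vdash^L_{\mathcal{B}}\{\varphi\}$ iff $\Vdash^L_{\mathcal{B}}\varphi$; $\Vdash^L_{\mathcal{B}}\Gamma\uplus\Delta$ iff $L=K\uplus M$ for some $K,M$ with $\Vdash^K_{\mathcal{B}}\Gamma$, $\Vdash^M_{\mathcal{B}}\Delta$. (Inf) For non-empty $\Gamma$, write $\Gamma=\,!\Delta\uplus\Theta$ with $!\Delta$ the elements whose top-level connective is $!$ and $\Theta$ the rest; $\Gamma\Vdash^L_{\mathcal{B}}\varphi$ iff for all $\mathcal{C}\supseteq\mathcal{B}$ and atomic $K$: if $\Vdash^{\varnothing}_{\mathcal{C}}\delta$ for every $\delta\in\Delta$ and $\Vdash^K_{\mathcal{C}}\Theta$, then $\Vdash^{L\uplus K}_{\mathcal{C}}\varphi$. For $\Gamma=\varnothing$, $\Gamma\Vdash^L_{\mathcal{B}}\varphi$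 means $\Vdash^L_{\mathcal{B}}\varphi$. -}

module Defs where

open import Level using (Level; Lift; lift) renaming (zero to lzero; suc to lsuc)
open import Data.Unit using (⊤)
open import Data.Product using (Σ; ∃; _×_; _,_; proj₁; proj₂)
open import Data.List using (List; []; _∷_; _++_; concat; map)
open import Data.List.Membership.Propositional using (_∈_)
open import Data.List.Relation.Unary.All using (All)
open import Data.List.Relation.Binary.Pointwise using (Pointwise)
open import Data.List.Relation.Binary.Permutation.Propositional using (_↭_)
open import Relation.Binary.PropositionalEquality using (_≡_)
open import Relation.Nullary using (¬_)

-- Everything is parameterised by the set of propositional atoms 𝔸.
-- Finite multisets are represented by lists; multiset union is _++_;
-- all notions below are invariant under permutation (_↭_).
module Semantics (Atom : Set) where

  AtomMS : Set
  AtomMS = List Atom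

  Sequent : Set
  Sequent = AtomMS × Atom

  Box : Set
  Box = List Sequent

  record Rule : Set where
    constructor ⟨_,_,_⟩
    field
      boxes : List Box
      sbox  : Box
      head  : Atom

  Base : Set₁
  Base = Rule → Set

  _⊇_ : Base → Base → Set
  C ⊇ B = ∀ r → B r → C r

  Persistent : Base → Atom → Set
  Persistent B p = Σ Box λ S → (¬ S ≡ []) × B ⟨ [] , S , p ⟩

  data Deriv (B : Base) : AtomMS → Atom → Set

  _⊢[_]_ : AtomMS → Base → Atom → Set
  P ⊢[ B ] p = Deriv B P p

  data Deriv B where
    ref : ∀ {p} → (p ∷ []) ⊢[ B ] p
    app : (As : List Box) (S : Box) (p : Atom) → B ⟨ As , S , p ⟩ →
          (Cs : List AtomMS) →
          Pointwise (λ C T → ∀ {Q q} → (Q , q) ∈ T → (C ++ Q) ⊢[ B ] q) Cs As →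
          -- pairs (C_j , d_j), m < j ≤ n, with d_j persistent and C_j ⊢ d_j
          (Ds : List (AtomMS × Atom)) →
          All (λ cd → Persistent B (proj₂ cd) × (proj₁ cd ⊢[ B ] proj₂ cd)) Ds →
          (∀ {U v} → (U , v) ∈ S → (map proj₂ Ds ++ U) ⊢[ B ] v) →
          ∀ {L} → L ↭ (concat Cs ++ concat (map proj₁ Ds)) →
          L ⊢[ B ] p

  data Formula : Set where
    atom : Atom → Formula
    ⊤'   : Formula
    𝟘    : Formula
    𝟙    : Formula
    _⊸_  : Formula → Formula → Formula
    _⊗_  : Formula → Formula → Formula
    _&_  : Formula → Formula → Formula
    _⊕_  : Formula → Formula → Formula
    !_   : Formula → Formula

  -- Semantic shape of a hypothesis in a context Γ for clause (Inf):
  -- a !-formula !δ contributes the requirement ⊩^∅_C δ,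
  -- any other formula θ contributes to the multiset Θ.
  data Hyp : Set₂ where
    banged : (Base → Set₁) → Hyp
    plain  : (Base → AtomMS → Set₁) → Hyp

  bangsHold : List Hyp → Base → Set₁
  bangsHold []               C = Lift _ ⊤
  bangsHold (banged P ∷ Hs)  C = P C × bangsHold Hs C
  bangsHold (plain _ ∷ Hs)   C = bangsHold Hs C

  plainSupp : List Hyp → Base → AtomMS → Set₁
  plainSupp []              C K = Lift _ (K ≡ [])
  plainSupp (banged _ ∷ Hs) C K = plainSupp Hs C K
  plainSupp (plain P ∷ Hs)  C K =
    Σ AtomMS λ K₁ → Σ AtomMS λ K₂ → (K ↭ (K₁ ++ K₂)) × P C K₁ × plainSupp Hs C K₂

  InfH : Base → AtomMS → List Hyp → (Base → AtomMS → Set₁) → Set₁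
  InfH B L Hs goal =
    ∀ (C : Base) → C ⊇ B → ∀ (K : AtomMS) →
      bangsHold Hs C → plainSupp Hs C K → goal C (L ++ K)

  mutual
    supp : Base → AtomMS → Formula → Set₁
    supp B L (atom p) = Lift _ (L ⊢[ B ] p)
    supp B L (φ ⊸ ψ)  = InfH B L (hyp φ ∷ []) (λ C K → supp C K ψ)
    supp B L (φ ⊗ ψ)  =
      ∀ (C : Base) → C ⊇ B → ∀ (K : AtomMS) (p : Atom) →
        InfH C K (hyp φ ∷ hyp ψ ∷ []) (λ D M → supp D M (atom p)) →
        supp C (L ++ K) (atom p)
    supp B L 𝟙 =
      ∀ (C : Base) → C ⊇ B → ∀ (K : AtomMS) (p : Atom) →
        supp C K (atom p) → supp C (L ++ K) (atom p)
    supp B L (φ & ψ)  = supp B L φ × supp B L ψ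
    supp B L (φ ⊕ ψ)  =
      ∀ (C : Base) → C ⊇ B → ∀ (K : AtomMS) (p : Atom) →
        InfH C K (hyp φ ∷ []) (λ D M → supp D M (atom p)) →
        InfH C K (hyp ψ ∷ []) (λ D M → supp D M (atom p)) →
        supp C (L ++ K) (atom p)
    supp B L 𝟘 = ∀ (p : Atom) (K : AtomMS) → supp B (L ++ K) (atom p)
    supp B L ⊤' = Lift _ ⊤
    supp B L (! φ) =
      ∀ (C : Base) → C ⊇ B → ∀ (K : AtomMS) (p : Atom) →
        (∀ (D : Base) → D ⊇ C → supp D [] φ → supp D K (atom p)) →
        supp C (L ++ K) (atom p)

    hyp : Formula → Hyp
    hyp (! δ) = banged (λ C → supp C [] δ)
    hyp φ     = plain (λ C K → supp C K φ)

  _⊩⟨_,_⟩_ : List Formula → Base → AtomMS → Formula → Set₁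
  []      ⊩⟨ B , L ⟩ φ = supp B L φ
  (γ ∷ Γ) ⊩⟨ B , L ⟩ φ = InfH B L (map hyp (γ ∷ Γ)) (λ C K → supp C K φ)

{-# OPTIONS --safe #-}
-- Only the case φ = ! δ needs an argument: then φ ⊩ ψ asks for ⊩^∅ δ while ! φ ⊩ ψ
-- supplies ⊩^∅ ! δ, so one needs dereliction ⊩^L ! δ ⇒ ⊩^L δ. The ! clause only yields
-- the atomic consequences of δ, but that suffices because support is determined by atomic
-- elimination: ⊩^L_B χ holds as soon as, for all C ⊇ B, K and atoms p, χ ⊩^K_C p implies
-- ⊩^{L ⊎ K}_C p (by induction on χ, cutting at the subformulae of & and ⊸).
module Submission where

open import Level using (lift)
open import Function using (_∘_)
open import Data.Unit using (tt)
open import Data.Product using (∃; _×_; _,_; proj₁; proj₂)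
open import Data.Sum using (_⊎_; inj₁; inj₂)
open import Data.List using ([]; _∷_; _++_; map)
open import Data.List.Membership.Propositional using (_∈_)
open import Data.List.Relation.Unary.All using (All; []; _∷_)
open import Data.List.Relation.Binary.Pointwise using (Pointwise; []; _∷_)
open import Data.List.Relation.Binary.Permutation.Propositional using (_↭_; ↭-sym; ↭-trans)
open import Data.List.Relation.Binary.Permutation.Propositional.Properties
  using (↭-singleton-inv; ++⁺ˡ; ++⁺ʳ; ++-comm; ++-identityʳ; ++-assoc)
open import Relation.Binary.PropositionalEquality using (_≡_; refl)
open import Defs

module SupportProperties (Atom : Set) where
  open Semantics Atom

  ⊇-refl : ∀ {B} → B ⊇ B
  ⊇-refl _ r = r

  ⊇-trans : ∀ {B C D} → C ⊇ B → D ⊇ C → D ⊇ B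
  ⊇-trans C⊇B D⊇C r = D⊇C r ∘ C⊇B r

  mutual
    ⊢-mono : ∀ {B C L p} → C ⊇ B → L ⊢[ B ] p → L ⊢[ C ] p
    ⊢-mono C⊇B ref = ref
    ⊢-mono C⊇B (app As S p r Cs premises Ds persistent sbox π) =
      app As S p (C⊇B _ r) Cs (boxes-mono C⊇B premises) Ds (persistent-mono C⊇B persistent)
          (⊢-mono C⊇B ∘ sbox) π

    boxes-mono : ∀ {B C Cs As} → C ⊇ B →
      Pointwise (λ K T → ∀ {Q q} → (Q , q) ∈ T → (K ++ Q) ⊢[ B ] q) Cs As →
      Pointwise (λ K T → ∀ {Q q} → (Q , q) ∈ T → (K ++ Q) ⊢[ C ] q) Cs As
    boxes-mono C⊇B [] = []
    boxes-mono C⊇B (d ∷ ds) = (⊢-mono C⊇B ∘ d) ∷ boxes-mono C⊇B ds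

    persistent-mono : ∀ {B C Ds} → C ⊇ B →
      All (λ cd → Persistent B (proj₂ cd) × (proj₁ cd ⊢[ B ] proj₂ cd)) Ds →
      All (λ cd → Persistent C (proj₂ cd) × (proj₁ cd ⊢[ C ] proj₂ cd)) Ds
    persistent-mono C⊇B [] = []
    persistent-mono C⊇B (((S , S≢[] , r) , d) ∷ ds) =
      ((S , S≢[] , C⊇B _ r) , ⊢-mono C⊇B d) ∷ persistent-mono C⊇B ds

  ⊢-resp-↭ : ∀ {B L L′ p} → L ↭ L′ → L ⊢[ B ] p → L′ ⊢[ B ] p
  ⊢-resp-↭ π ref with refl ← ↭-singleton-inv (↭-sym π) = ref
  ⊢-resp-↭ π (app As S p r Cs premises Ds persistent sbox π′) =
    app As S p r Cs premises Ds persistent sbox (↭-trans (↭-sym π) π′)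

  supp-mono : ∀ χ {B C L} → C ⊇ B → supp B L χ → supp C L χ
  supp-mono (atom _) C⊇B (lift d)  = lift (⊢-mono C⊇B d)
  supp-mono ⊤'       C⊇B s         = s
  supp-mono 𝟘        C⊇B s         = λ p K → supp-mono (atom p) C⊇B (s p K)
  supp-mono 𝟙        C⊇B s         = λ D D⊇C → s D (⊇-trans C⊇B D⊇C)
  supp-mono (φ ⊸ ψ)  C⊇B s         = λ D D⊇C → s D (⊇-trans C⊇B D⊇C)
  supp-mono (φ ⊗ ψ)  C⊇B s         = λ D D⊇C → s D (⊇-trans C⊇B D⊇C)
  supp-mono (φ & ψ)  C⊇B (sφ , sψ) = supp-mono φ C⊇B sφ , supp-mono ψ C⊇B sψ
  supp-mono (φ ⊕ ψ)  C⊇B s         = λ D D⊇C → s D (⊇-trans C⊇B D⊇C)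
  supp-mono (! φ)    C⊇B s         = λ D D⊇C → s D (⊇-trans C⊇B D⊇C)

  supp-resp-↭ : ∀ χ {B L L′} → L ↭ L′ → supp B L χ → supp B L′ χ
  supp-resp-↭ (atom _) π (lift d)  = lift (⊢-resp-↭ π d)
  supp-resp-↭ ⊤'       π s         = s
  supp-resp-↭ 𝟘        π s         = λ p K → supp-resp-↭ (atom p) (++⁺ʳ K π) (s p K)
  supp-resp-↭ 𝟙        π s         = λ C C⊇B K p → supp-resp-↭ (atom p) (++⁺ʳ K π) ∘ s C C⊇B K p
  supp-resp-↭ (φ ⊸ ψ)  π s         = λ C C⊇B K bs ps → supp-resp-↭ ψ (++⁺ʳ K π) (s C C⊇B K bs ps)
  supp-resp-↭ (φ ⊗ ψ)  π s         = λ C C⊇B K p → supp-resp-↭ (atom p) (++⁺ʳ K π) ∘ s C C⊇B K p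
  supp-resp-↭ (φ & ψ)  π (sφ , sψ) = supp-resp-↭ φ π sφ , supp-resp-↭ ψ π sψ
  supp-resp-↭ (φ ⊕ ψ)  π s         = λ C C⊇B K p φ⊩p → supp-resp-↭ (atom p) (++⁺ʳ K π) ∘ s C C⊇B K p φ⊩p
  supp-resp-↭ (! φ)    π s         = λ C C⊇B K p → supp-resp-↭ (atom p) (++⁺ʳ K π) ∘ s C C⊇B K p

  [_]⊩⟨_,_⟩_ : Formula → Base → AtomMS → Atom → Set₁
  [ χ ]⊩⟨ C , K ⟩ p = (χ ∷ []) ⊩⟨ C , K ⟩ atom p

  ⊩-mono : ∀ Γ χ {C D K} → D ⊇ C → Γ ⊩⟨ C , K ⟩ χ → Γ ⊩⟨ D , K ⟩ χ
  ⊩-mono []      χ D⊇C s       = supp-mono χ D⊇C s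
  ⊩-mono (_ ∷ _) _ D⊇C H E E⊇D = H E (⊇-trans D⊇C E⊇D)

  -- hyp χ only computes once the head of χ is known.
  bang-or-plain : ∀ χ → (∃ λ δ → χ ≡ ! δ) ⊎ (hyp χ ≡ plain (λ C K → supp C K χ))
  bang-or-plain (atom _) = inj₂ refl
  bang-or-plain ⊤'       = inj₂ refl
  bang-or-plain 𝟘        = inj₂ refl
  bang-or-plain 𝟙        = inj₂ refl
  bang-or-plain (φ ⊸ ψ)  = inj₂ refl
  bang-or-plain (φ ⊗ ψ)  = inj₂ refl
  bang-or-plain (φ & ψ)  = inj₂ refl
  bang-or-plain (φ ⊕ ψ)  = inj₂ refl
  bang-or-plain (! δ)    = inj₁ (δ , refl)

  plain-⊩-intro : ∀ {P C K p} → (∀ D → D ⊇ C → ∀ M → P D M → supp D (M ++ K) (atom p)) →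
    InfH C K (plain P ∷ []) (λ D M → supp D M (atom p))
  plain-⊩-intro {K = K} {p} f D D⊇C M _ (M₁ , _ , M↭M₁++[] , s , lift refl) =
    supp-resp-↭ (atom p) M₁++K↭K++M (f D D⊇C M₁ s)
    where
    M₁++K↭K++M : M₁ ++ K ↭ K ++ M
    M₁++K↭K++M = ↭-trans (++-comm M₁ K) (++⁺ˡ K (↭-sym (↭-trans M↭M₁++[] (++-identityʳ M₁))))

  plain-⊩-elim : ∀ {χ C K} ψ → hyp χ ≡ plain (λ D M → supp D M χ) →
    (χ ∷ []) ⊩⟨ C , K ⟩ ψ → ∀ D → D ⊇ C → ∀ {M} → supp D M χ → supp D (K ++ M) ψ
  plain-⊩-elim _ eq H D D⊇C {M} s rewrite eq =
    H D D⊇C M (lift tt) (M , [] , ↭-sym (++-identityʳ M) , s , lift refl)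

  bangsHold-mono : ∀ Γ {C D} → D ⊇ C → bangsHold (map hyp Γ) C → bangsHold (map hyp Γ) D
  bangsHold-mono []      D⊇C b = b
  bangsHold-mono (γ ∷ Γ) D⊇C b with bang-or-plain γ
  ... | inj₁ (δ , refl) = supp-mono δ D⊇C (proj₁ b) , bangsHold-mono Γ D⊇C (proj₂ b)
  ... | inj₂ eq rewrite eq = bangsHold-mono Γ D⊇C b

  plainSupp-mono : ∀ Γ {C D K} → D ⊇ C → plainSupp (map hyp Γ) C K → plainSupp (map hyp Γ) D K
  plainSupp-mono []      D⊇C s = s
  plainSupp-mono (γ ∷ Γ) D⊇C s with bang-or-plain γ
  ... | inj₁ (δ , refl) = plainSupp-mono Γ D⊇C s
  ... | inj₂ eq rewrite eq =
    let K₁ , K₂ , K↭K₁++K₂ , sγ , sΓ = s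
    in  K₁ , K₂ , K↭K₁++K₂ , supp-mono γ D⊇C sγ , plainSupp-mono Γ D⊇C sΓ

  cut : ∀ χ {C D X M p} → D ⊇ C → supp D X χ → [ χ ]⊩⟨ C , M ⟩ p → supp D (X ++ M) (atom p)
  cut χ {D = D} {X} {M} {p} D⊇C s H with bang-or-plain χ
  ... | inj₁ (δ , refl) = s D ⊇-refl M p λ E E⊇D sδ →
    supp-resp-↭ (atom p) (++-identityʳ M) (H E (⊇-trans D⊇C E⊇D) [] (sδ , lift tt) (lift refl))
  ... | inj₂ eq = supp-resp-↭ (atom p) (++-comm M X) (plain-⊩-elim (atom p) eq H D D⊇C s)

  ElimSupp : Base → AtomMS → Formula → Set₁
  ElimSupp B L χ = ∀ C → C ⊇ B → ∀ K p → [ χ ]⊩⟨ C , K ⟩ p → supp C (L ++ K) (atom p)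

  elimSupp⇒supp : ∀ χ {B L} → ElimSupp B L χ → supp B L χ
  elimSupp⇒supp (atom q) {B} {L} H = supp-resp-↭ (atom q) (++-identityʳ L)
    (H B ⊇-refl [] q (plain-⊩-intro λ _ _ M → supp-resp-↭ (atom q) (↭-sym (++-identityʳ M))))
  elimSupp⇒supp ⊤' H = lift tt
  elimSupp⇒supp 𝟘 {B} H p K = H B ⊇-refl K p (plain-⊩-intro λ _ _ _ s → s p K)
  elimSupp⇒supp 𝟙 H C C⊇B K p sp = H C C⊇B K p (plain-⊩-intro λ D D⊇C _ s →
    s D ⊇-refl K p (supp-mono (atom p) D⊇C sp))
  elimSupp⇒supp (φ ⊸ ψ) {B} {L} H C C⊇B K bs ps = elimSupp⇒supp ψ λ D D⊇C M p ψ⊩p →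
    supp-resp-↭ (atom p) (↭-sym (++-assoc L K M)) (H D (⊇-trans C⊇B D⊇C) (K ++ M) p
      (plain-⊩-intro λ E E⊇D N φ⊸ψ →
        supp-resp-↭ (atom p) (++-assoc N K M) (cut ψ E⊇D (apply E (⊇-trans D⊇C E⊇D) φ⊸ψ) ψ⊩p)))
    where
    apply : ∀ E → E ⊇ C → ∀ {N} → supp E N (φ ⊸ ψ) → supp E (N ++ K) ψ
    apply E E⊇C φ⊸ψ =
      φ⊸ψ E ⊇-refl K (bangsHold-mono (φ ∷ []) E⊇C bs) (plainSupp-mono (φ ∷ []) E⊇C ps)
  elimSupp⇒supp (φ ⊗ ψ) H C C⊇B K p φψ⊩p = H C C⊇B K p (plain-⊩-intro λ D D⊇C _ s →
    s D ⊇-refl K p (⊩-mono (φ ∷ ψ ∷ []) (atom p) D⊇C φψ⊩p))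
  elimSupp⇒supp (φ & ψ) H =
    elimSupp⇒supp φ (λ C C⊇B K p φ⊩p → H C C⊇B K p (plain-⊩-intro λ D D⊇C _ s →
      cut φ D⊇C (proj₁ s) φ⊩p)) ,
    elimSupp⇒supp ψ (λ C C⊇B K p ψ⊩p → H C C⊇B K p (plain-⊩-intro λ D D⊇C _ s →
      cut ψ D⊇C (proj₂ s) ψ⊩p))
  elimSupp⇒supp (φ ⊕ ψ) H C C⊇B K p φ⊩p ψ⊩p = H C C⊇B K p (plain-⊩-intro λ D D⊇C _ s →
    s D ⊇-refl K p (⊩-mono (φ ∷ []) (atom p) D⊇C φ⊩p) (⊩-mono (ψ ∷ []) (atom p) D⊇C ψ⊩p))
  elimSupp⇒supp (! δ) H C C⊇B K p δ⇒p = H C C⊇B K p λ { D D⊇C .[] (sδ , _) (lift refl) →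
    supp-resp-↭ (atom p) (↭-sym (++-identityʳ K)) (δ⇒p D D⊇C sδ) }

  dereliction : ∀ δ {B L} → supp B L (! δ) → supp B L δ
  dereliction δ s = elimSupp⇒supp δ λ C C⊇B K p δ⊩p →
    s C C⊇B K p λ D D⊇C sδ → cut δ D⊇C sδ δ⊩p

open SupportProperties using (bang-or-plain; plain-⊩-elim; dereliction)

mainTheorem12 : (Atom : Set) → let open Semantics Atom in
    ∀ (B : Base) (L : AtomMS) (φ ψ : Formula) →
      (φ ∷ []) ⊩⟨ B , L ⟩ ψ → ((! φ) ∷ []) ⊩⟨ B , L ⟩ ψ
mainTheorem12 Atom B L φ ψ φ⊩ψ C C⊇B .[] (sφ , _) (lift refl) with bang-or-plain Atom φ
... | inj₁ (δ , refl) = φ⊩ψ C C⊇B [] (dereliction Atom δ sφ , lift tt) (lift refl)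
... | inj₂ eq         = plain-⊩-elim Atom ψ eq φ⊩ψ C C⊇B sφ
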